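{- The equivariant Nielsen–Schreier theorem is false (its negation is provable) in homotopy type theory, in extensional type theory and in classical mathematics. Moreover, it remains false if it is restricted to finite index subgroups of free groups on finitely many generators.
   Context: Groups are sets with a binary operation satisfying the usual axioms; $F_A$ denotes the free group on a set $A$. The equivariant Nielsen–Schreier theorem is the statement that for each set $A$ and each subgroup $H \hookrightarrow F_A$ we can choose (a function giving) a subset $C_{A,H}\hookrightarrow H$ that freely generates $H$ (the induced homomorphism $F_{C_{A,H}}\to H$ is an isomorphism), such that for every equivalence $\pi : A \to A'$, writing $\tilde\pi : F_A \cong F_{A'}$ for the induced isomorphism, we have $C_{A',\tilde\pi(H)} = \tilde\pi(C_{A,H})$. The restricted version quantifies only over finite sets $A$ and subgroups $H$ of finite index. -}

module Defs where

open import Data.Bool using (Bool; true; false; not; if_then_else_)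
open import Data.Nat using (ℕ)
open import Data.Fin using (Fin)
open import Data.List using (List; []; _∷_; _++_; map; reverse; concatMap)
open import Data.Product using (Σ; Σ-syntax; _×_; _,_; proj₁; map₁; map₂)
open import Function.Bundles using (_↔_; Inverse)
open import Relation.Binary.PropositionalEquality using (_≡_)

-- Free groups, presented as words modulo free reduction (a setoid).
-- A letter (false , x) stands for x, (true , x) for x⁻¹.

Word : Set → Set
Word X = List (Bool × X)

-- The congruence on words generated by cancellation x^b x^(¬b) ~ ε,
-- relative to an equality _≈_ on the generators (so that free groups
-- on setoids, e.g. on subsets of a free group, can be formed).
data FG~ {X : Set} (_≈_ : X → X → Set) : Word X → Word X → Set where
  fg-refl   : ∀ {u} → FG~ _≈_ u u
  fg-sym    : ∀ {u v} → FG~ _≈_ u v → FG~ _≈_ v u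
  fg-trans  : ∀ {u v w} → FG~ _≈_ u v → FG~ _≈_ v w → FG~ _≈_ u w
  fg-cancel : ∀ u v b {x y} → x ≈ y →
              FG~ _≈_ (u ++ (b , x) ∷ (not b , y) ∷ v) (u ++ v)
  fg-letter : ∀ u v b {x y} → x ≈ y →
              FG~ _≈_ (u ++ (b , x) ∷ v) (u ++ (b , y) ∷ v)

_≈F_ : {A : Set} → Word A → Word A → Set
_≈F_ = FG~ _≡_

-- Group operations of F_A: multiplication is concatenation, unit is [].
invW : {A : Set} → Word A → Word A
invW w = reverse (map (map₁ not) w)

record Subgroup (A : Set) : Set₁ where
  field
    P        : Word A → Set
    P-resp   : ∀ {u v} → u ≈F v → P u → P v
    P-ε      : P []
    P-mul    : ∀ {u v} → P u → P v → P (u ++ v)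
    P-inv    : ∀ {u} → P u → P (invW u)
open Subgroup public

-- Finite index: the set of left cosets wH is in bijection with Fin index,
-- via a surjection coset whose fibres are exactly the cosets.
record FiniteIndex {A : Set} (H : Subgroup A) : Set where
  field
    index      : ℕ
    coset      : Word A → Fin index
    coset-surj : ∀ i → Σ (Word A) λ w → coset w ≡ i
    same-coset : ∀ u v → (coset u ≡ coset v → P H (invW u ++ v))
                       × (P H (invW u ++ v) → coset u ≡ coset v)

-- Free generation: C ⊆ H is a subset of F_A and the induced homomorphism
-- F_C → H is an isomorphism (bijective).

module _ {A : Set} (C : Word A → Set) where
  Gen : Set
  Gen = Σ (Word A) C

  _≈G_ : Gen → Gen → Set
  g ≈G g' = proj₁ g ≈F proj₁ g'

  evalGen : Word Gen → Word A
  evalGen = concatMap (λ { (b , (w , _)) → if b then invW w else w })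

record FreelyGenerates {A : Set} (H : Subgroup A) (C : Word A → Set) : Set where
  field
    C-resp : ∀ {u v} → u ≈F v → C u → C v
    C⊆H    : ∀ w → C w → P H w
    surj   : ∀ w → P H w → Σ (Word (Gen C)) λ u → evalGen C u ≈F w
    inj    : ∀ u v → evalGen C u ≈F evalGen C v → FG~ (_≈G_ C) u v

π̃ : {A A' : Set} → A ↔ A' → Word A → Word A'
π̃ π = map (map₂ (Inverse.to π))

Img : {A A' : Set} → A ↔ A' → (Word A → Set) → Word A' → Set
Img {A} π S w' = Σ (Word A) λ w → S w × (π̃ π w ≈F w')

_≐_ : {X : Set} → (X → Set) → (X → Set) → Set
S ≐ T = ∀ x → (S x → T x) × (T x → S x)

ENS : Set₁
ENS = Σ ((A : Set) → Subgroup A → Word A → Set) λ C →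
        (∀ A H → FreelyGenerates H (C A H))
      × (∀ {A A'} (π : A ↔ A') (H : Subgroup A) (H' : Subgroup A') →
           P H' ≐ Img π (P H) → C A' H' ≐ Img π (C A H))

record FinSet : Set₁ where
  field
    Carrier : Set
    size    : ℕ
    enum    : Carrier ↔ Fin size
open FinSet public

FISubgroup : Set → Set₁
FISubgroup A = Σ (Subgroup A) FiniteIndex

ENSfin : Set₁
ENSfin = Σ ((A : FinSet) → FISubgroup (Carrier A) → Word (Carrier A) → Set) λ C →
           (∀ A H → FreelyGenerates (proj₁ H) (C A H))
         × (∀ {A A'} (π : Carrier A ↔ Carrier A') (H : FISubgroup (Carrier A))
              (H' : FISubgroup (Carrier A')) →
              P (proj₁ H') ≐ Img π (P (proj₁ H)) → C A' H' ≐ Img π (C A H))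

-- Let A = {a, b}, H ⊆ F_A the index-2 subgroup of even-length words, and σ the
-- swap of a and b, which preserves H. The number Q w of a's in w (mod 2) is a
-- homomorphism F_A → ℤ/2, and the parity h w of the number of pairs "a before b"
-- in w is well defined on F_A and satisfies h w + h (σ w) = Q w on H. If C were a
-- σ-invariant basis of H, summing h over the letters of a word in C would give a
-- homomorphism ψ : F_C → ℤ/2 with ψ + ψ ∘ σ = Q. For x = a b⁻¹ ∈ H we have
-- x · σ x = 1, hence 0 = ψ (x · σ x) = Q x = 1. Any ENS restricts to ENSfin, and
-- A and H are finite, so both versions fail.

module Submission where

open import Defs
open import Data.Product using (_×_)
open import Relation.Nullary using (¬_)

open import Data.Bool using (Bool; true; false; not; _∧_; _xor_; if_then_else_)
open import Data.Bool.Properties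
  using (xor-assoc; xor-comm; xor-same; xor-identityʳ; xor-inverseˡ; not-involutive; ∧-inverseˡ; ∧-idem; xor-∧-commutativeRing)
open import Data.Empty using (⊥)
open import Data.Fin using (Fin)
open import Data.Fin.Patterns using (0F; 1F)
open import Data.Fin.Properties using (2↔Bool)
open import Data.List using ([]; _∷_; _++_; map; reverse; foldr; [_])
open import Data.List.Properties using (++-assoc; map-++; foldr-++; foldr-map; unfold-reverse; reverse-map; concatMap-++)
open import Data.Product using (_,_; proj₁; proj₂; map₁; map₂)
open import Function using (_∘_; id; _$_)
open import Function.Bundles using (_↔_; Inverse; Injection; mk↔ₛ′)
open import Function.Properties.Inverse using (↔-sym; Inverse⇒Injection)
open import Relation.Binary.PropositionalEquality
  using (_≡_; _≢_; refl; sym; trans; cong; cong₂; subst; subst₂; module ≡-Reasoning)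
open import Algebra.Bundles using (CommutativeRing)
open import Algebra.Properties.CommutativeSemigroup (CommutativeRing.+-commutativeSemigroup xor-∧-commutativeRing)
  using (interchange)

true≢false : true ≢ false
true≢false ()

xor-cancelˡ : ∀ x y → x xor (x xor y) ≡ y
xor-cancelˡ x y = trans (sym (xor-assoc x x y)) (cong (_xor y) (xor-same x))

xor≡false⇒≡ : ∀ x y → x xor y ≡ false → x ≡ y
xor≡false⇒≡ false false _ = refl
xor≡false⇒≡ true  true  _ = refl

≡⇒xor≡false : ∀ x y → x ≡ y → x xor y ≡ false
≡⇒xor≡false x _ refl = xor-same x

module _ {X : Set} {_≈_ : X → X → Set} where

  ++-congˡ : ∀ p {u v} → FG~ _≈_ u v → FG~ _≈_ (p ++ u) (p ++ v)
  ++-congˡ p fg-refl          = fg-refl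
  ++-congˡ p (fg-sym r)       = fg-sym (++-congˡ p r)
  ++-congˡ p (fg-trans r s)   = fg-trans (++-congˡ p r) (++-congˡ p s)
  ++-congˡ p (fg-cancel u v b e) =
    subst₂ (FG~ _≈_) (++-assoc p u _) (++-assoc p u v) (fg-cancel (p ++ u) v b e)
  ++-congˡ p (fg-letter u v b e) =
    subst₂ (FG~ _≈_) (++-assoc p u _) (++-assoc p u _) (fg-letter (p ++ u) v b e)

  ++-congʳ : ∀ s {u v} → FG~ _≈_ u v → FG~ _≈_ (u ++ s) (v ++ s)
  ++-congʳ s fg-refl          = fg-refl
  ++-congʳ s (fg-sym r)       = fg-sym (++-congʳ s r)
  ++-congʳ s (fg-trans r t)   = fg-trans (++-congʳ s r) (++-congʳ s t)
  ++-congʳ s (fg-cancel u v b e) =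
    subst₂ (FG~ _≈_) (sym (++-assoc u _ s)) (sym (++-assoc u v s)) (fg-cancel u (v ++ s) b e)
  ++-congʳ s (fg-letter u v b e) =
    subst₂ (FG~ _≈_) (sym (++-assoc u _ s)) (sym (++-assoc u _ s)) (fg-letter u (v ++ s) b e)

signed : {A : Set} → Bool → Word A → Word A
signed b w = if b then invW w else w

rename : {A B : Set} → (A → B) → Word A → Word B
rename f = map (map₂ f)

module _ {A B : Set} (f : A → B) where

  rename-resp : ∀ {u v} → u ≈F v → rename f u ≈F rename f v
  rename-resp fg-refl                = fg-refl
  rename-resp (fg-sym r)             = fg-sym (rename-resp r)
  rename-resp (fg-trans r s)         = fg-trans (rename-resp r) (rename-resp s)
  rename-resp (fg-cancel u v b refl) =
    subst₂ _≈F_ (sym (map-++ _ u _)) (sym (map-++ _ u v)) (fg-cancel (rename f u) (rename f v) b refl)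
  rename-resp (fg-letter u v b refl) = fg-refl

  rename-invW : ∀ w → rename f (invW w) ≡ invW (rename f w)
  rename-invW w = trans (reverse-map (map₂ f) (map (map₁ not) w)) (cong reverse (swap-maps w))
    where
    swap-maps : ∀ w → rename f (map (map₁ not) w) ≡ map (map₁ not) (rename f w)
    swap-maps []      = refl
    swap-maps (_ ∷ w) = cong (_ ∷_) (swap-maps w)

  evalGen-rename : ∀ {C : Word A → Set} {D : Word B → Set} (g : Gen C → Gen D) →
                   (∀ x → proj₁ (g x) ≡ rename f (proj₁ x)) →
                   ∀ u → evalGen D (rename g u) ≡ rename f (evalGen C u)
  evalGen-rename g g-over-f [] = refl
  evalGen-rename {C} g g-over-f ((b , x) ∷ u) =
    trans (cong₂ _++_ (letter b) (evalGen-rename g g-over-f u))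
          (sym (map-++ _ (signed b (proj₁ x)) (evalGen C u)))
    where
    letter : ∀ b → signed b (proj₁ (g x)) ≡ rename f (signed b (proj₁ x))
    letter false = g-over-f x
    letter true  = trans (cong invW (g-over-f x)) (sym (rename-invW (proj₁ x)))

module _ {X T : Set} where

  actWord : (X → T → T) → T → Word X → T
  actWord act t = foldr (act ∘ proj₂) t

  actWord-resp : ∀ {_≈_ : X → X → Set} {act : X → T → T} →
                 (∀ {x y} → x ≈ y → ∀ t → act x t ≡ act y t) →
                 (∀ x t → act x (act x t) ≡ t) →
                 ∀ t {u v} → FG~ _≈_ u v → actWord act t u ≡ actWord act t v
  actWord-resp act-resp act-involutive t fg-refl        = refl
  actWord-resp act-resp act-involutive t (fg-sym r)     = sym (actWord-resp act-resp act-involutive t r)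
  actWord-resp act-resp act-involutive t (fg-trans r s) =
    trans (actWord-resp act-resp act-involutive t r) (actWord-resp act-resp act-involutive t s)
  actWord-resp {act = act} act-resp act-involutive t (fg-cancel u v b {x} {y} x≈y) = begin
    foldr f t (u ++ (b , x) ∷ (not b , y) ∷ v)    ≡⟨ foldr-++ f t u _ ⟩
    foldr f (act x (act y (foldr f t v))) u       ≡⟨ cong (λ s → foldr f (act x s) u) (act-resp x≈y _) ⟨
    foldr f (act x (act x (foldr f t v))) u       ≡⟨ cong (λ s → foldr f s u) (act-involutive x _) ⟩
    foldr f (foldr f t v) u                       ≡⟨ foldr-++ f t u v ⟨
    foldr f t (u ++ v)                            ∎
    where
    open ≡-Reasoning
    f = act ∘ proj₂
  actWord-resp {act = act} act-resp act-involutive t (fg-letter u v b {x} {y} x≈y) =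
    trans (foldr-++ f t u _)
          (trans (cong (λ s → foldr f s u) (act-resp x≈y _)) (sym (foldr-++ f t u _)))
    where
    f = act ∘ proj₂

  actWord-cong : ∀ {act act' : X → T → T} → (∀ x t → act x t ≡ act' x t) →
                 ∀ t w → actWord act t w ≡ actWord act' t w
  actWord-cong act≗act' t []            = refl
  actWord-cong {act} act≗act' t ((_ , x) ∷ w) =
    trans (cong (act x) (actWord-cong act≗act' t w)) (act≗act' x _)

actWord-rename : ∀ {X Y T : Set} (act : Y → T → T) (f : X → Y) t w →
                 actWord act t (rename f w) ≡ actWord (act ∘ f) t w
actWord-rename act f t w = foldr-map (act ∘ proj₂) (map₂ f) t w

module _ {X : Set} where

  odd : (X → Bool) → Word X → Bool
  odd p = actWord (λ x → p x xor_) false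

  odd-resp : ∀ {_≈_ : X → X → Set} (p : X → Bool) → (∀ {x y} → x ≈ y → p x ≡ p y) →
             ∀ {u v} → FG~ _≈_ u v → odd p u ≡ odd p v
  odd-resp p p-resp = actWord-resp (λ x≈y t → cong (_xor t) (p-resp x≈y)) (xor-cancelˡ ∘ p) false

  odd-++ : ∀ p u v → odd p (u ++ v) ≡ odd p u xor odd p v
  odd-++ p []            v = refl
  odd-++ p ((_ , x) ∷ u) v = trans (cong (p x xor_) (odd-++ p u v)) (sym (xor-assoc (p x) _ _))

  odd-invW : ∀ p w → odd p (invW w) ≡ odd p w
  odd-invW p []            = refl
  odd-invW p ((b , x) ∷ w) = begin
    odd p (invW ((b , x) ∷ w))            ≡⟨ cong (odd p) (unfold-reverse (not b , x) (map (map₁ not) w)) ⟩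
    odd p (invW w ++ [ not b , x ])       ≡⟨ odd-++ p (invW w) _ ⟩
    odd p (invW w) xor (p x xor false)    ≡⟨ cong₂ _xor_ (odd-invW p w) (xor-identityʳ (p x)) ⟩
    odd p w xor p x                       ≡⟨ xor-comm (odd p w) (p x) ⟩
    p x xor odd p w                       ∎
    where open ≡-Reasoning

  odd-xor : ∀ p q w → odd p w xor odd q w ≡ odd (λ x → p x xor q x) w
  odd-xor p q []            = refl
  odd-xor p q ((_ , x) ∷ w) =
    trans (interchange (p x) (odd p w) (q x) (odd q w)) (cong ((p x xor q x) xor_) (odd-xor p q w))

  odd-cong : ∀ {p q} → (∀ x → p x ≡ q x) → ∀ w → odd p w ≡ odd q w
  odd-cong p≗q = actWord-cong (λ x t → cong (_xor t) (p≗q x)) false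

odd-rename : ∀ {X Y : Set} (p : Y → Bool) (f : X → Y) w → odd p (rename f w) ≡ odd (p ∘ f) w
odd-rename p f = actWord-rename _ f false

odd-evalGen : ∀ {A : Set} {C : Word A → Set} p u → odd p (evalGen C u) ≡ odd (odd p ∘ proj₁) u
odd-evalGen p []                 = refl
odd-evalGen {C = C} p ((b , x) ∷ u) =
  trans (odd-++ p (signed b (proj₁ x)) (evalGen C u))
        (cong₂ _xor_ (letter b) (odd-evalGen p u))
  where
  letter : ∀ b → odd p (signed b (proj₁ x)) ≡ odd p (proj₁ x)
  letter false = refl
  letter true  = odd-invW p (proj₁ x)

∧-xor-cancel : ∀ a b n c → a ∧ b ≡ false → (a ∧ (b xor n)) xor ((a ∧ n) xor c) ≡ c
∧-xor-cancel false b     n c _ = refl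
∧-xor-cancel true  false n c _ = xor-cancelˡ n c

∧-xor-expand : ∀ a b m n → a ∧ b ≡ false →
               ((a ∧ n) xor (b ∧ m)) xor (m ∧ n) ≡ (a xor m) ∧ (b xor n)
∧-xor-expand false false m     n     _ = refl
∧-xor-expand false true  false n     _ = refl
∧-xor-expand false true  true  n     _ = refl
∧-xor-expand true  false false false _ = refl
∧-xor-expand true  false true  false _ = refl
∧-xor-expand true  false false true  _ = refl
∧-xor-expand true  false true  true  _ = refl

module _ {X : Set} (p q : X → Bool) where

  -- pairs p q w is the parity of #{(i , j) | i < j, p wᵢ, q wⱼ}; the first component counts q.
  pairAct : X → Bool × Bool → Bool × Bool
  pairAct x (n , c) = q x xor n , (p x ∧ n) xor c

  pairCount : Word X → Bool × Bool
  pairCount = actWord pairAct (false , false)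

  pairs : Word X → Bool
  pairs = proj₂ ∘ pairCount

  proj₁-pairCount : ∀ w → proj₁ (pairCount w) ≡ odd q w
  proj₁-pairCount []            = refl
  proj₁-pairCount ((_ , x) ∷ w) = cong (q x xor_) (proj₁-pairCount w)

  pairs-resp : (∀ x → p x ∧ q x ≡ false) → ∀ {u v} → u ≈F v → pairs u ≡ pairs v
  pairs-resp disjoint = cong proj₂ ∘ actWord-resp (λ { refl t → refl }) pairAct-involutive (false , false)
    where
    pairAct-involutive : ∀ x t → pairAct x (pairAct x t) ≡ t
    pairAct-involutive x (n , c) =
      cong₂ _,_ (xor-cancelˡ (q x) n) (∧-xor-cancel (p x) (q x) n c (disjoint x))

pairs-flip : ∀ {X : Set} (p q : X → Bool) → (∀ x → p x ∧ q x ≡ false) →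
             ∀ w → pairs p q w xor pairs q p w ≡ odd p w ∧ odd q w
pairs-flip p q disjoint []            = refl
pairs-flip p q disjoint ((_ , x) ∷ w) = begin
  ((p x ∧ proj₁ (pairCount p q w)) xor pairs p q w) xor ((q x ∧ proj₁ (pairCount q p w)) xor pairs q p w)
    ≡⟨ cong₂ (λ n m → ((p x ∧ n) xor pairs p q w) xor ((q x ∧ m) xor pairs q p w))
             (proj₁-pairCount p q w) (proj₁-pairCount q p w) ⟩
  ((p x ∧ odd q w) xor pairs p q w) xor ((q x ∧ odd p w) xor pairs q p w)
    ≡⟨ interchange (p x ∧ odd q w) (pairs p q w) (q x ∧ odd p w) (pairs q p w) ⟩
  ((p x ∧ odd q w) xor (q x ∧ odd p w)) xor (pairs p q w xor pairs q p w)
    ≡⟨ cong (((p x ∧ odd q w) xor (q x ∧ odd p w)) xor_) (pairs-flip p q disjoint w) ⟩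
  ((p x ∧ odd q w) xor (q x ∧ odd p w)) xor (odd p w ∧ odd q w)
    ≡⟨ ∧-xor-expand (p x) (q x) (odd p w) (odd q w) (disjoint x) ⟩
  (p x xor odd p w) ∧ (q x xor odd q w)
    ∎
  where open ≡-Reasoning

parity : {A : Set} → Word A → Bool
parity = odd (λ _ → true)

parity-resp : ∀ {A : Set} {u v : Word A} → u ≈F v → parity u ≡ parity v
parity-resp = odd-resp _ (λ _ → refl)

parity-invW-++ : ∀ {A : Set} (u v : Word A) → parity (invW u ++ v) ≡ parity u xor parity v
parity-invW-++ u v = trans (odd-++ _ (invW u) v) (cong (_xor parity v) (odd-invW _ u))

evenWords : (A : Set) → Subgroup A
evenWords A = record
  { P      = λ w → parity w ≡ false
  ; P-resp = λ u≈v even → trans (sym (parity-resp u≈v)) even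
  ; P-ε    = refl
  ; P-mul  = λ {u} {v} even-u even-v → trans (odd-++ _ u v) (cong₂ _xor_ even-u even-v)
  ; P-inv  = λ {u} even → trans (odd-invW _ u) even
  }

bool↔fin2 : Bool ↔ Fin 2
bool↔fin2 = ↔-sym 2↔Bool

evenWords-finiteIndex : ∀ {A : Set} → A → FiniteIndex (evenWords A)
evenWords-finiteIndex a = record
  { index      = 2
  ; coset      = Inverse.to bool↔fin2 ∘ parity
  ; coset-surj = λ { 0F → [] , refl ; 1F → [ false , a ] , refl }
  ; same-coset = λ u v →
      (λ same → trans (parity-invW-++ u v)
                      (≡⇒xor≡false _ _ (Injection.injective (Inverse⇒Injection bool↔fin2) same)))
    , (λ even → cong (Inverse.to bool↔fin2)
                     (xor≡false⇒≡ _ _ (trans (sym (parity-invW-++ u v)) even)))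
  }

swap : Bool ↔ Bool
swap = mk↔ₛ′ not not not-involutive not-involutive

rename-not-involutive : ∀ w → rename not (rename not w) ≡ w
rename-not-involutive []            = refl
rename-not-involutive ((b , x) ∷ w) = cong₂ _∷_ (cong (b ,_) (not-involutive x)) (rename-not-involutive w)

evenWords-swap-invariant : P (evenWords Bool) ≐ Img swap (P (evenWords Bool))
evenWords-swap-invariant w =
    (λ even → rename not w , trans (odd-rename _ not w) even
                           , subst (rename not (rename not w) ≈F_) (rename-not-involutive w) fg-refl)
  , (λ { (w₀ , even , w₀≈w) → trans (sym (parity-resp w₀≈w)) (trans (odd-rename _ not w₀) even) })

-- The generators a and b are false and true.
aCount : Word Bool → Bool
aCount = odd not

abPairs : Word Bool → Bool
abPairs = pairs not id

abPairs-resp : ∀ {u v} → u ≈F v → abPairs u ≡ abPairs v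
abPairs-resp = pairs-resp not id ∧-inverseˡ

abPairs-swap : ∀ w → abPairs (rename not w) ≡ pairs id not w
abPairs-swap w = cong proj₂ (trans (actWord-rename (pairAct not id) not (false , false) w)
                                   (actWord-cong swapped (false , false) w))
  where
  swapped : ∀ x t → pairAct not id (not x) t ≡ pairAct id not x t
  swapped x (n , c) = cong (λ y → not x xor n , (y ∧ n) xor c) (not-involutive x)

aCount≡bCount : ∀ w → parity w ≡ false → aCount w ≡ odd id w
aCount≡bCount w even = xor≡false⇒≡ _ _ $ begin
  odd not w xor odd id w          ≡⟨ odd-xor not id w ⟩
  odd (λ x → not x xor x) w       ≡⟨ odd-cong xor-inverseˡ w ⟩
  parity w                        ≡⟨ even ⟩
  false                           ∎
  where open ≡-Reasoning

abPairs-swap-sum : ∀ w → parity w ≡ false → abPairs w xor abPairs (rename not w) ≡ aCount w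
abPairs-swap-sum w even = begin
  abPairs w xor abPairs (rename not w)   ≡⟨ cong (abPairs w xor_) (abPairs-swap w) ⟩
  pairs not id w xor pairs id not w      ≡⟨ pairs-flip not id ∧-inverseˡ w ⟩
  aCount w ∧ odd id w                    ≡⟨ cong (aCount w ∧_) (aCount≡bCount w even) ⟨
  aCount w ∧ aCount w                    ≡⟨ ∧-idem (aCount w) ⟩
  aCount w                               ∎
  where open ≡-Reasoning

ab⁻¹ : Word Bool
ab⁻¹ = (false , false) ∷ (true , true) ∷ []

ab⁻¹-swap-cancel : (ab⁻¹ ++ rename not ab⁻¹) ≈F []
ab⁻¹-swap-cancel = fg-trans (fg-cancel [ false , false ] [ true , false ] true refl) (fg-cancel [] [] false refl)

module _ (C : Word Bool → Set) (basis : FreelyGenerates (evenWords Bool) C)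
         (C-swap-invariant : C ≐ Img swap C) where
  open FreelyGenerates basis

  swapGen : Gen C → Gen C
  swapGen (w , w∈C) = rename not w , proj₂ (C-swap-invariant (rename not w)) (w , w∈C , fg-refl)

  ψ : Word (Gen C) → Bool
  ψ = odd (abPairs ∘ proj₁)

  ψ-swap-sum : ∀ u → ψ u xor ψ (rename swapGen u) ≡ aCount (evalGen C u)
  ψ-swap-sum u = begin
    ψ u xor ψ (rename swapGen u)                                  ≡⟨ cong (ψ u xor_) (odd-rename (abPairs ∘ proj₁) swapGen u) ⟩
    odd (abPairs ∘ proj₁) u xor odd (abPairs ∘ rename not ∘ proj₁) u ≡⟨ odd-xor (abPairs ∘ proj₁) (abPairs ∘ rename not ∘ proj₁) u ⟩
    odd (λ g → abPairs (proj₁ g) xor abPairs (rename not (proj₁ g))) u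
      ≡⟨ odd-cong (λ { (w , w∈C) → abPairs-swap-sum w (C⊆H w w∈C) }) u ⟩
    odd (aCount ∘ proj₁) u                                        ≡⟨ odd-evalGen not u ⟨
    aCount (evalGen C u)                                          ∎
    where open ≡-Reasoning

  ψ-swap-sum≡false : ∀ u → evalGen C u ≈F ab⁻¹ → ψ u xor ψ (rename swapGen u) ≡ false
  ψ-swap-sum≡false u u≈ab⁻¹ =
    trans (sym (odd-++ (abPairs ∘ proj₁) u (rename swapGen u)))
          (odd-resp (abPairs ∘ proj₁) abPairs-resp (inj (u ++ rename swapGen u) [] u·swap-u≈1))
    where
    evalGen-u·swap-u : evalGen C (u ++ rename swapGen u) ≡ evalGen C u ++ rename not (evalGen C u)
    evalGen-u·swap-u = trans (concatMap-++ _ u (rename swapGen u))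
                             (cong (evalGen C u ++_) (evalGen-rename not swapGen (λ _ → refl) u))

    u·swap-u≈1 : evalGen C (u ++ rename swapGen u) ≈F []
    u·swap-u≈1 = subst (_≈F []) (sym evalGen-u·swap-u)
      (fg-trans (++-congʳ _ u≈ab⁻¹) (fg-trans (++-congˡ ab⁻¹ (rename-resp not u≈ab⁻¹)) ab⁻¹-swap-cancel))

  no-swap-invariant-basis : ⊥
  no-swap-invariant-basis with surj ab⁻¹ refl
  ... | u , u≈ab⁻¹ = true≢false $ begin
    true                           ≡⟨ odd-resp not (cong not) u≈ab⁻¹ ⟨
    aCount (evalGen C u)           ≡⟨ ψ-swap-sum u ⟨
    ψ u xor ψ (rename swapGen u)   ≡⟨ ψ-swap-sum≡false u u≈ab⁻¹ ⟩
    false                          ∎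
    where open ≡-Reasoning

boolFinSet : FinSet
boolFinSet = record { Carrier = Bool ; size = 2 ; enum = bool↔fin2 }

ENS⇒ENSfin : ENS → ENSfin
ENS⇒ENSfin (C , basis , equivariant) =
    (λ A H → C (Carrier A) (proj₁ H))
  , (λ A H → basis (Carrier A) (proj₁ H))
  , (λ π H H' → equivariant π (proj₁ H) (proj₁ H'))

¬ENSfin : ¬ ENSfin
¬ENSfin (C , basis , equivariant) =
  no-swap-invariant-basis (C boolFinSet H) (basis boolFinSet H)
    (equivariant {boolFinSet} {boolFinSet} swap H H evenWords-swap-invariant)
  where
  H : FISubgroup Bool
  H = evenWords Bool , evenWords-finiteIndex false

theorem7p4 : ¬ ENS × ¬ ENSfin
theorem7p4 = ¬ENSfin ∘ ENS⇒ENSfin , ¬ENSfin
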